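{- Let $G$ be a finite simple undirected graph and $\delta>0$, and run the following procedure. Choose a maximum independent set $S$ of $G$ and label its vertices $1,2,\dots,|S|$. Let $L$ be the set of vertices of $G$ having exactly one neighbour in $S$. Initialize $x=\mathbf{1}_S$ and $\bar G=G$. For $i=1,2,\dots,|S|$ in turn: set $C_i=N_{\bar G}(i)\cap L$ and $\bar C_i=C_i\cup\{i\}$; set $x_j=\frac{1}{1+(|\bar C_i|-1)\delta}$ for all $j\in\bar C_i$; then replace $\bar G$ by its induced subgraph on $V(\bar G)\setminus(\bar C_i\cup N_{\bar G}(\bar C_i))$. Then each $\bar C_i$ ($1\le i\le |S|$) is a clique of $G$, and for $i\neq j$ the cliques $\bar C_i$ and $\bar C_j$ are independent.
   Context: $N_H(v)$ is the set of neighbours of $v$ in graph $H$; for a vertex set $K$, $N_H(K)=\bigcup_{v\in K}N_H(v)\setminus K$. $\mathbf{1}_S$ is the characteristic vector of $S$. Two cliques of a graph are independent if no vertex of one clique is adjacent to any vertex of the other. -}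

module Defs where

open import Data.Nat using (ℕ; _≤_; _≡ᵇ_)
open import Data.Bool using (Bool; true; false; if_then_else_; T)
open import Data.Fin using (Fin)
open import Data.Fin.Subset using (Subset; _∈_; _∩_; _∪_; _─_; ⋃; ∣_∣; ⁅_⁆; ⊥)
open import Data.List using (List; []; _∷_; map; allFin)
open import Data.List.Membership.Propositional using () renaming (_∈_ to _∈ₗ_)
open import Data.List.Relation.Unary.Unique.Propositional using (Unique)
open import Data.Vec using (tabulate; lookup)
open import Data.Product using (_×_)
open import Function.Bundles using (_⇔_)
open import Relation.Binary.PropositionalEquality using (_≡_; _≢_)

record Graph (n : ℕ) : Set where
  field
    adj   : Fin n → Fin n → Bool
    sym   : ∀ u v → adj u v ≡ adj v u
    irrefl : ∀ v → adj v v ≡ false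
open Graph public

module _ {n : ℕ} (G : Graph n) where

  N : Fin n → Subset n
  N v = tabulate (λ u → adj G v u)

  IsIndependent : Subset n → Set
  IsIndependent S = ∀ u v → u ∈ S → v ∈ S → adj G u v ≡ false

  IsMaximumIndependent : Subset n → Set
  IsMaximumIndependent S = IsIndependent S × (∀ T → IsIndependent T → ∣ T ∣ ≤ ∣ S ∣)

  IsClique : Subset n → Set
  IsClique K = ∀ u v → u ∈ K → v ∈ K → u ≢ v → adj G u v ≡ true

  IndependentCliques : Subset n → Subset n → Set
  IndependentCliques K K' = ∀ u v → u ∈ K → v ∈ K' → adj G u v ≡ false

  Lset : Subset n → Subset n
  Lset S = tabulate (λ u → ∣ N u ∩ S ∣ ≡ᵇ 1)

  -- The current graph Ḡ is the induced subgraph of G on a vertex set V.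
  -- N_Ḡ(v) = N_G(v) ∩ V
  NG : Subset n → Fin n → Subset n
  NG V v = N v ∩ V

  NGset : Subset n → Subset n → Subset n
  NGset V K = ⋃ (map (λ w → if lookup K w then NG V w else ⊥) (allFin n)) ─ K

  loop : Subset n → Subset n → List (Fin n) → List (Subset n)
  loop L V [] = []
  loop L V (i ∷ is) =
    let C  = NG V i ∩ L
        C̄  = C ∪ ⁅ i ⁆
        V' = V ─ (C̄ ∪ NGset V C̄)
    in C̄ ∷ loop L V' is

  cliquesOf : Subset n → List (Fin n) → List (Subset n)
  cliquesOf S order = loop (Lset S) (tabulate (λ _ → true)) order

  -- `order` is a labelling of the vertices of S by 1..|S|
  IsLabelling : Subset n → List (Fin n) → Set
  IsLabelling S order = Unique order × (∀ v → (v ∈ₗ order) ⇔ (v ∈ S))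

-- A vertex of L adjacent to i ∈ S has i as its only neighbour in S. Two such
-- neighbours u, v of i are adjacent, for otherwise exchanging i for u and v in S
-- would give a larger independent set; hence every C̄_i is a clique. The vertex
-- set in which a later C̄_j is formed avoids C̄_i together with all its
-- neighbours, so only the centre j of C̄_j (which may already have been removed)
-- needs a separate argument: j is not adjacent to i because S is independent,
-- nor to the rest of C̄_i, whose unique neighbour in S is i.
module Submission where

open import Defs hiding (sym)
open import Data.Nat using (ℕ; suc; _+_; _≤_; _<_; z≤n; s≤s)
open import Data.Nat.Properties using (≤-trans; +-monoʳ-≤; n≤1+n; +-suc; +-comm; ≡ᵇ⇒≡; <⇒≱; module ≤-Reasoning)
open import Data.Bool using (Bool; true; false; if_then_else_)
open import Data.Bool.Properties using (T-≡)
open import Data.Fin using (Fin; zero; suc; _≟_)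
open import Data.Fin.Subset using (Subset; _∈_; _∉_; _⊆_; _⊂_; _∩_; _∪_; _─_; _-_; ⋃; ∣_∣; ⁅_⁆; ⊥; inside; outside)
open import Data.Fin.Subset.Properties
  using (drop-there; x∈p∪q⁺; x∈p∪q⁻; x∈p∩q⁺; x∈p∩q⁻; p─q⊆p; x∈p∧x∉q⇒x∈p─q; x∈p∧x≢y⇒x∈p-y;
         x∈⁅x⁆; x∈⁅y⁆⇒x≡y; x∉⁅y⁆⇒x≢y; ∣⁅x⁆∣≡1; x∈p⇒∣p-x∣<∣p∣; p⊆q⇒∣p∣≤∣q∣; p⊂q⇒∣p∣<∣q∣)
open import Data.List using (List; []; _∷_; length; lookup; map; allFin)
open import Data.List.Membership.Propositional using () renaming (_∈_ to _∈ₗ_)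
open import Data.List.Membership.Propositional.Properties using (∈-map⁺; ∈-allFin; ∈-lookup)
open import Data.List.Relation.Unary.Any using (here; there)
open import Data.List.Relation.Unary.All as All using (All; []; _∷_)
open import Data.List.Relation.Unary.AllPairs using (AllPairs; []; _∷_)
open import Data.List.Relation.Unary.Unique.Propositional using (Unique)
open import Data.Vec using (tabulate; []; _∷_) renaming (lookup to vlookup)
open import Data.Vec.Properties using (lookup∘tabulate; []=⇒lookup; lookup⇒[]=)
open import Data.Product using (_×_; _,_; proj₁; proj₂)
open import Data.Sum using (_⊎_; inj₁; inj₂)
open import Function using (_∘_)
open import Function.Bundles using (Equivalence)
open import Relation.Binary.Definitions using (Symmetric)
open import Relation.Nullary using (yes; no; contradiction)
open import Relation.Binary.PropositionalEquality using (_≡_; _≢_; refl; sym; trans; cong; subst)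

private
  variable
    n : ℕ

∈-tabulate⁻ : (f : Fin n → Bool) {x : Fin n} → x ∈ tabulate f → f x ≡ true
∈-tabulate⁻ f {x} x∈ = trans (sym (lookup∘tabulate f x)) ([]=⇒lookup x∈)

∈-tabulate⁺ : (f : Fin n → Bool) {x : Fin n} → f x ≡ true → x ∈ tabulate f
∈-tabulate⁺ f {x} fx = lookup⇒[]= x (tabulate f) (trans (lookup∘tabulate f x) fx)

x∈p─q⇒x∉q : (p q : Subset n) {x : Fin n} → x ∈ p ─ q → x ∉ q
x∈p─q⇒x∉q (_ ∷ p) (outside ∷ q) {zero}  _   ()
x∈p─q⇒x∉q (_ ∷ p) (inside  ∷ q) {zero}  ()  _
x∈p─q⇒x∉q (_ ∷ p) (_       ∷ q) {suc x} x∈ x∈q = x∈p─q⇒x∉q p q (drop-there x∈) (drop-there x∈q)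

x∈⋃⁺ : {x : Fin n} {p : Subset n} (ps : List (Subset n)) → x ∈ p → p ∈ₗ ps → x ∈ ⋃ ps
x∈⋃⁺ (q ∷ ps) x∈p (here refl) = x∈p∪q⁺ (inj₁ x∈p)
x∈⋃⁺ (q ∷ ps) x∈p (there p∈)  = x∈p∪q⁺ (inj₂ (x∈⋃⁺ ps x∈p p∈))

∣p∣≤∣p─q∣+∣q∣ : (p q : Subset n) → ∣ p ∣ ≤ ∣ p ─ q ∣ + ∣ q ∣
∣p∣≤∣p─q∣+∣q∣ []            []            = z≤n
∣p∣≤∣p─q∣+∣q∣ (outside ∷ p) (outside ∷ q) = ∣p∣≤∣p─q∣+∣q∣ p q
∣p∣≤∣p─q∣+∣q∣ (outside ∷ p) (inside  ∷ q) = ≤-trans (∣p∣≤∣p─q∣+∣q∣ p q) (+-monoʳ-≤ ∣ p ─ q ∣ (n≤1+n ∣ q ∣))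
∣p∣≤∣p─q∣+∣q∣ (inside  ∷ p) (outside ∷ q) = s≤s (∣p∣≤∣p─q∣+∣q∣ p q)
∣p∣≤∣p─q∣+∣q∣ (inside  ∷ p) (inside  ∷ q) =
  subst (suc ∣ p ∣ ≤_) (sym (+-suc ∣ p ─ q ∣ ∣ q ∣)) (s≤s (∣p∣≤∣p─q∣+∣q∣ p q))

∣p∣≤1+∣p-x∣ : (p : Subset n) (x : Fin n) → ∣ p ∣ ≤ suc ∣ p - x ∣
∣p∣≤1+∣p-x∣ p x = subst (∣ p ∣ ≤_) eq (∣p∣≤∣p─q∣+∣q∣ p ⁅ x ⁆)
  where
  eq : ∣ p - x ∣ + ∣ ⁅ x ⁆ ∣ ≡ suc ∣ p - x ∣
  eq = trans (cong (∣ p - x ∣ +_) (∣⁅x⁆∣≡1 x)) (+-comm ∣ p - x ∣ 1)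

∣p∣≡1⇒x≡y : (p : Subset n) {x y : Fin n} → ∣ p ∣ ≡ 1 → x ∈ p → y ∈ p → x ≡ y
∣p∣≡1⇒x≡y p {x} {y} ∣p∣≡1 x∈p y∈p with x ≟ y
... | yes x≡y = x≡y
... | no  x≢y = contradiction (subst (2 ≤_) ∣p∣≡1 two≤∣p∣) λ { (s≤s ()) }
  where
  ⁅y⁆⊆p-x : ⁅ y ⁆ ⊆ p - x
  ⁅y⁆⊆p-x z∈ = subst (_∈ p - x) (sym (x∈⁅y⁆⇒x≡y y z∈)) (x∈p∧x≢y⇒x∈p-y y∈p (x≢y ∘ sym))
  two≤∣p∣ : 2 ≤ ∣ p ∣
  two≤∣p∣ = ≤-trans (s≤s (subst (_≤ ∣ p - x ∣) (∣⁅x⁆∣≡1 y) (p⊆q⇒∣p∣≤∣q∣ ⁅y⁆⊆p-x))) (x∈p⇒∣p-x∣<∣p∣ x∈p)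

p⊂p∪⁅x⁆ : {p : Subset n} {x : Fin n} → x ∉ p → p ⊂ p ∪ ⁅ x ⁆
p⊂p∪⁅x⁆ {x = x} x∉p = (x∈p∪q⁺ ∘ inj₁) , x , x∈p∪q⁺ (inj₂ (x∈⁅x⁆ x)) , x∉p

exchange : Subset n → Fin n → Fin n → Fin n → Subset n
exchange p x y z = ((p - x) ∪ ⁅ y ⁆) ∪ ⁅ z ⁆

∈-exchange⁻ : (p : Subset n) (x y z : Fin n) {w : Fin n} → w ∈ exchange p x y z →
              (w ∈ p × w ≢ x) ⊎ (w ≡ y ⊎ w ≡ z)
∈-exchange⁻ p x y z w∈ with x∈p∪q⁻ ((p - x) ∪ ⁅ y ⁆) ⁅ z ⁆ w∈
... | inj₂ w∈⁅z⁆ = inj₂ (inj₂ (x∈⁅y⁆⇒x≡y z w∈⁅z⁆))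
... | inj₁ w∈′ with x∈p∪q⁻ (p - x) ⁅ y ⁆ w∈′
...   | inj₂ w∈⁅y⁆ = inj₂ (inj₁ (x∈⁅y⁆⇒x≡y y w∈⁅y⁆))
...   | inj₁ w∈p-x = inj₁ (p─q⊆p p ⁅ x ⁆ w∈p-x , x∉⁅y⁆⇒x≢y (x∈p─q⇒x∉q p ⁅ x ⁆ w∈p-x))

∣p∣<∣exchange∣ : {p : Subset n} {x y z : Fin n} → x ∈ p → y ∉ p → z ∉ p → y ≢ z →
                 ∣ p ∣ < ∣ exchange p x y z ∣
∣p∣<∣exchange∣ {p = p} {x} {y} {z} x∈p y∉p z∉p y≢z = begin-strict
  ∣ p ∣                ≤⟨ ∣p∣≤1+∣p-x∣ p x ⟩
  suc ∣ p - x ∣        ≤⟨ p⊂q⇒∣p∣<∣q∣ (p⊂p∪⁅x⁆ y∉p-x) ⟩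
  ∣ (p - x) ∪ ⁅ y ⁆ ∣  <⟨ p⊂q⇒∣p∣<∣q∣ (p⊂p∪⁅x⁆ z∉p-x∪⁅y⁆) ⟩
  ∣ exchange p x y z ∣ ∎
  where
  open ≤-Reasoning
  y∉p-x : y ∉ p - x
  y∉p-x = y∉p ∘ p─q⊆p p ⁅ x ⁆
  z∉p-x∪⁅y⁆ : z ∉ (p - x) ∪ ⁅ y ⁆
  z∉p-x∪⁅y⁆ z∈ with x∈p∪q⁻ (p - x) ⁅ y ⁆ z∈
  ... | inj₁ z∈p-x = z∉p (p─q⊆p p ⁅ x ⁆ z∈p-x)
  ... | inj₂ z∈⁅y⁆ = y≢z (sym (x∈⁅y⁆⇒x≡y y z∈⁅y⁆))

AllPairs⇒lookup : {A : Set} {R : A → A → Set} {xs : List A} → Symmetric R → AllPairs R xs →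
                  (k l : Fin (length xs)) → k ≢ l → R (lookup xs k) (lookup xs l)
AllPairs⇒lookup R-sym (_  ∷ _)   zero    zero    k≢l = contradiction refl k≢l
AllPairs⇒lookup R-sym (Rx ∷ _)   zero    (suc l) _   = All.lookup Rx (∈-lookup l)
AllPairs⇒lookup R-sym (Rx ∷ _)   (suc k) zero    _   = R-sym (All.lookup Rx (∈-lookup k))
AllPairs⇒lookup R-sym (_  ∷ Rxs) (suc k) (suc l) k≢l = AllPairs⇒lookup R-sym Rxs k l (k≢l ∘ cong suc)

module _ (G : Graph n) where

  IndependentCliques-sym : Symmetric (IndependentCliques G)
  IndependentCliques-sym indep u v u∈ v∈ = trans (Graph.sym G u v) (indep v u v∈ u∈)

  closedNbhd : Subset n → Subset n → Subset n
  closedNbhd V K = K ∪ NGset G V K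

  ∉closedNbhd⇒nonadjacent : {V K : Subset n} {u w : Fin n} → u ∈ K → w ∈ V → w ∉ closedNbhd V K →
                            adj G u w ≡ false
  ∉closedNbhd⇒nonadjacent {V} {K} {u} {w} u∈K w∈V w∉ with adj G u w in uw
  ... | false = refl
  ... | true  = contradiction (x∈p∪q⁺ (inj₂ w∈NGset)) w∉
    where
    w∉K : w ∉ K
    w∉K = w∉ ∘ x∈p∪q⁺ ∘ inj₁
    around : Fin n → Subset n
    around z = if vlookup K z then NG G V z else ⊥
    w∈around-u : w ∈ around u
    w∈around-u = subst (λ b → w ∈ (if b then NG G V u else ⊥))
                       (sym ([]=⇒lookup u∈K)) (x∈p∩q⁺ (∈-tabulate⁺ (adj G u) uw , w∈V))
    w∈NGset : w ∈ NGset G V K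
    w∈NGset = x∈p∧x∉q⇒x∈p─q (x∈⋃⁺ (map around (allFin n)) w∈around-u (∈-map⁺ around (∈-allFin u))) w∉K

  -- With Ḡ = G[V], these are the paper's C̄_i and the vertex set of Ḡ after step i:
  -- loop G L V (i ∷ is) unfolds to C̄ L V i ∷ loop G L (remaining L V i) is.
  C̄ : Subset n → Subset n → Fin n → Subset n
  C̄ L V i = (NG G V i ∩ L) ∪ ⁅ i ⁆

  remaining : Subset n → Subset n → Fin n → Subset n
  remaining L V i = V ─ closedNbhd V (C̄ L V i)

  ∈-C̄⁻ : {L V : Subset n} {i x : Fin n} → x ∈ C̄ L V i → x ≡ i ⊎ (adj G i x ≡ true × x ∈ V × x ∈ L)
  ∈-C̄⁻ {L} {V} {i} {x} x∈ with x∈p∪q⁻ (NG G V i ∩ L) ⁅ i ⁆ x∈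
  ... | inj₂ x∈⁅i⁆ = inj₁ (x∈⁅y⁆⇒x≡y i x∈⁅i⁆)
  ... | inj₁ x∈C with x∈p∩q⁻ (NG G V i) L x∈C
  ...   | x∈NG , x∈L with x∈p∩q⁻ (N G i) V x∈NG
  ...     | x∈N , x∈V = inj₂ (∈-tabulate⁻ (adj G i) x∈N , x∈V , x∈L)

  module _ {S : Subset n} (indS : IsIndependent G S) where

    private
      L : Subset n
      L = Lset G S

    ∈S-adjacent⇒∉S : {i u : Fin n} → i ∈ S → adj G i u ≡ true → u ∉ S
    ∈S-adjacent⇒∉S {i} {u} i∈S iu u∈S = contradiction (trans (sym iu) (indS i u i∈S u∈S)) λ ()

    Lset-unique-neighbour : {u a b : Fin n} → u ∈ L → a ∈ S → b ∈ S →
                            adj G u a ≡ true → adj G u b ≡ true → a ≡ b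
    Lset-unique-neighbour {u} u∈L a∈S b∈S ua ub =
      ∣p∣≡1⇒x≡y (N G u ∩ S) ∣N∩S∣≡1 (x∈p∩q⁺ (∈-tabulate⁺ (adj G u) ua , a∈S))
                                      (x∈p∩q⁺ (∈-tabulate⁺ (adj G u) ub , b∈S))
      where
      ∣N∩S∣≡1 : ∣ N G u ∩ S ∣ ≡ 1
      ∣N∩S∣≡1 = ≡ᵇ⇒≡ _ 1 (Equivalence.from T-≡ (∈-tabulate⁻ _ u∈L))

    Lset-nonadjacent : {u i a : Fin n} → u ∈ L → adj G i u ≡ true → i ∈ S → a ∈ S → a ≢ i →
                       adj G a u ≡ false
    Lset-nonadjacent {u} {i} {a} u∈L iu i∈S a∈S a≢i with adj G a u in au
    ... | false = refl
    ... | true  = contradiction (Lset-unique-neighbour u∈L a∈S i∈S (trans (Graph.sym G u a) au)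
                                                                    (trans (Graph.sym G u i) iu)) a≢i

    exchange-independent : {i u v : Fin n} → i ∈ S → u ∈ L → v ∈ L → adj G i u ≡ true → adj G i v ≡ true →
                           adj G u v ≡ false → IsIndependent G (exchange S i u v)
    exchange-independent {i} {u} {v} i∈S u∈L v∈L iu iv uv a b a∈ b∈
      with ∈-exchange⁻ S i u v a∈ | ∈-exchange⁻ S i u v b∈
    ... | inj₁ (a∈S , _)   | inj₁ (b∈S , _)   = indS a b a∈S b∈S
    ... | inj₁ (a∈S , a≢i) | inj₂ (inj₁ refl) = Lset-nonadjacent u∈L iu i∈S a∈S a≢i
    ... | inj₁ (a∈S , a≢i) | inj₂ (inj₂ refl) = Lset-nonadjacent v∈L iv i∈S a∈S a≢i
    ... | inj₂ (inj₁ refl) | inj₁ (b∈S , b≢i) = trans (Graph.sym G u b) (Lset-nonadjacent u∈L iu i∈S b∈S b≢i)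
    ... | inj₂ (inj₂ refl) | inj₁ (b∈S , b≢i) = trans (Graph.sym G v b) (Lset-nonadjacent v∈L iv i∈S b∈S b≢i)
    ... | inj₂ (inj₁ refl) | inj₂ (inj₁ refl) = irrefl G u
    ... | inj₂ (inj₂ refl) | inj₂ (inj₂ refl) = irrefl G v
    ... | inj₂ (inj₁ refl) | inj₂ (inj₂ refl) = uv
    ... | inj₂ (inj₂ refl) | inj₂ (inj₁ refl) = trans (Graph.sym G v u) uv

    C̄-independent : {V W : Subset n} {i j : Fin n} → i ∈ S → j ∈ S → i ≢ j → W ⊆ remaining L V i →
                    IndependentCliques G (C̄ L V i) (C̄ L W j)
    C̄-independent {V} {W} {i} {j} i∈S j∈S i≢j W⊆ u w u∈ w∈ with ∈-C̄⁻ w∈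
    ... | inj₂ (_ , w∈W , _) = ∉closedNbhd⇒nonadjacent u∈ (p─q⊆p V _ (W⊆ w∈W)) (x∈p─q⇒x∉q V _ (W⊆ w∈W))
    ... | inj₁ refl with ∈-C̄⁻ u∈
    ...   | inj₁ refl           = indS i j i∈S j∈S
    ...   | inj₂ (iu , _ , u∈L) = trans (Graph.sym G u j) (Lset-nonadjacent u∈L iu i∈S j∈S (i≢j ∘ sym))

    C̄-independent-of-loop : {V W : Subset n} {i : Fin n} {js : List (Fin n)} → i ∈ S → All (_∈ S) js →
                            All (i ≢_) js → W ⊆ remaining L V i →
                            All (IndependentCliques G (C̄ L V i)) (loop G L W js)
    C̄-independent-of-loop i∈S []            []            W⊆ = []
    C̄-independent-of-loop i∈S (j∈S ∷ js⊆S) (i≢j ∷ i∉js) W⊆ =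
      C̄-independent i∈S j∈S i≢j W⊆ ∷ C̄-independent-of-loop i∈S js⊆S i∉js (W⊆ ∘ p─q⊆p _ _)

    loop-pairwise-independent : {V : Subset n} {is : List (Fin n)} → All (_∈ S) is → Unique is →
                                AllPairs (IndependentCliques G) (loop G L V is)
    loop-pairwise-independent []            []              = []
    loop-pairwise-independent (i∈S ∷ is⊆S) (i∉is ∷ unique) =
      C̄-independent-of-loop i∈S is⊆S i∉is (λ w∈ → w∈) ∷ loop-pairwise-independent is⊆S unique

  module _ {S : Subset n} (maxS : IsMaximumIndependent G S) where

    private
      L : Subset n
      L = Lset G S
      indS : IsIndependent G S
      indS = proj₁ maxS

    Lset-common-neighbours-adjacent : {i u v : Fin n} → i ∈ S → u ∈ L → v ∈ L →
                                      adj G i u ≡ true → adj G i v ≡ true → u ≢ v → adj G u v ≡ true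
    Lset-common-neighbours-adjacent {i} {u} {v} i∈S u∈L v∈L iu iv u≢v with adj G u v in uv
    ... | true  = refl
    ... | false = contradiction (proj₂ maxS (exchange S i u v) (exchange-independent indS i∈S u∈L v∈L iu iv uv))
                                (<⇒≱ (∣p∣<∣exchange∣ i∈S (∈S-adjacent⇒∉S indS i∈S iu) (∈S-adjacent⇒∉S indS i∈S iv) u≢v))

    C̄-isClique : {V : Subset n} {i : Fin n} → i ∈ S → IsClique G (C̄ L V i)
    C̄-isClique {V} {i} i∈S u v u∈ v∈ u≢v with ∈-C̄⁻ u∈ | ∈-C̄⁻ v∈
    ... | inj₁ refl           | inj₁ refl           = contradiction refl u≢v
    ... | inj₁ refl           | inj₂ (iv , _ , _)   = iv
    ... | inj₂ (iu , _ , _)   | inj₁ refl           = trans (Graph.sym G u i) iu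
    ... | inj₂ (iu , _ , u∈L) | inj₂ (iv , _ , v∈L) = Lset-common-neighbours-adjacent i∈S u∈L v∈L iu iv u≢v

    loop-cliques : {V : Subset n} {is : List (Fin n)} → All (_∈ S) is → All (IsClique G) (loop G L V is)
    loop-cliques []            = []
    loop-cliques (i∈S ∷ is⊆S) = C̄-isClique i∈S ∷ loop-cliques is⊆S

lemma4p4 : ∀ {n : ℕ} (G : Graph n) (S : Subset n) (order : List (Fin n)) →
    IsMaximumIndependent G S →
    IsLabelling G S order →
    (∀ (k : Fin (length (cliquesOf G S order))) →
       IsClique G (lookup (cliquesOf G S order) k))
    × (∀ (k l : Fin (length (cliquesOf G S order))) → k ≢ l →
       IndependentCliques G (lookup (cliquesOf G S order) k) (lookup (cliquesOf G S order) l))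
lemma4p4 G S order maxS (unique , labels) =
    (λ k → All.lookup (loop-cliques G maxS order⊆S) (∈-lookup k))
  , AllPairs⇒lookup (IndependentCliques-sym G) (loop-pairwise-independent G (proj₁ maxS) order⊆S unique)
  where
  order⊆S : All (_∈ S) order
  order⊆S = All.tabulate (Equivalence.to (labels _))
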